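{- Let $n\neq 2$ be a positive integer. Then $K_n\times H$ is type I for every finite simple bipartite graph $H$.
   Context: All graphs are finite and simple. $K_n$ is the complete graph on $n$ vertices. A total colouring of a graph is an assignment of colours to its vertices and edges such that any two adjacent vertices, any two incident edges, and any vertex and an edge incident with it receive different colours. A graph $G$ with maximum degree $\Delta(G)$ is type I if it has a total colouring using $\Delta(G)+1$ colours. The direct product $G\times H$ has vertex set $V(G)\times V(H)$, with $(u,v)$ adjacent to $(u',v')$ if and only if $uu'\in E(G)$ and $vv'\in E(H)$. -}

module Defs where

open import Data.Nat using (ℕ; zero; suc; _+_; _*_; _⊔_)
open import Data.Fin using (Fin; remQuot)
open import Data.Bool using (Bool; true; false; _∧_; if_then_else_)
open import Data.Product using (_×_; _,_; Σ; ∃; proj₁; proj₂)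
open import Data.List using (List; map; foldr)
open import Data.Nat.ListAction using (sum)
open import Data.List.Base using (allFin)
open import Relation.Binary.PropositionalEquality using (_≡_; _≢_)

record Graph : Set where
  field
    order : ℕ
    adj   : Fin order → Fin order → Bool
    sym   : ∀ u v → adj u v ≡ adj v u
    irrefl : ∀ u → adj u u ≡ false
open Graph public

Adj : (G : Graph) → Fin (order G) → Fin (order G) → Set
Adj G u v = adj G u v ≡ true

degree : (G : Graph) → Fin (order G) → ℕ
degree G u = sum (map (λ v → if adj G u v then 1 else 0) (allFin (order G)))

maxDegree : Graph → ℕ
maxDegree G = foldr (λ u acc → degree G u ⊔ acc) 0 (allFin (order G))

record TotalColouring (G : Graph) (k : ℕ) : Set where
  field
    vcol : Fin (order G) → Fin k
    ecol : (u v : Fin (order G)) → Adj G u v → Fin k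
    ecol-sym : ∀ u v (p : Adj G u v) (q : Adj G v u) → ecol u v p ≡ ecol v u q
    vv : ∀ u v → Adj G u v → vcol u ≢ vcol v
    ee : ∀ u v w (p : Adj G u v) (q : Adj G u w) → v ≢ w → ecol u v p ≢ ecol u w q
    ve : ∀ u v (p : Adj G u v) → vcol u ≢ ecol u v p

TypeI : Graph → Set
TypeI G = TotalColouring G (suc (maxDegree G))

Bipartite : Graph → Set
Bipartite G = Σ (Fin (order G) → Bool) λ side →
  ∀ u v → Adj G u v → side u ≢ side v

K : ℕ → Graph
K n = record { order = n ; adj = λ u v → notEq u v ; sym = symNE ; irrefl = irrNE }
  where
  open import Data.Fin using (_≟_)
  open import Relation.Nullary using (yes; no)
  open import Relation.Binary.PropositionalEquality using (refl)
  notEq : Fin n → Fin n → Bool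
  notEq u v with u ≟ v
  ... | yes _ = false
  ... | no _  = true
  symNE : ∀ u v → notEq u v ≡ notEq v u
  symNE u v with u ≟ v | v ≟ u
  ... | yes _ | yes _ = refl
  ... | no _  | no _  = refl
  ... | yes e | no ne = Data.Empty.⊥-elim (ne (Relation.Binary.PropositionalEquality.sym e))
    where import Data.Empty
  ... | no ne | yes e = Data.Empty.⊥-elim (ne (Relation.Binary.PropositionalEquality.sym e))
    where import Data.Empty
  irrNE : ∀ u → notEq u u ≡ false
  irrNE u with u ≟ u
  ... | yes _ = refl
  ... | no ne = Data.Empty.⊥-elim (ne refl)
    where import Data.Empty

-- direct (tensor) product G × H; vertex (g , h) is encoded in Fin (|G| * |H|)
-- via remQuot (the standard bijection Fin (m * n) ≃ Fin m × Fin n)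
_×ᴳ_ : Graph → Graph → Graph
G ×ᴳ H = record
  { order = order G * order H
  ; adj = λ x y → adjP (remQuot (order H) x) (remQuot (order H) y)
  ; sym = λ x y → symP (remQuot (order H) x) (remQuot (order H) y)
  ; irrefl = λ x → irrP (remQuot (order H) x)
  }
  where
  open import Relation.Binary.PropositionalEquality using (cong₂; refl)
  adjP : Fin (order G) × Fin (order H) → Fin (order G) × Fin (order H) → Bool
  adjP (g , h) (g' , h') = adj G g g' ∧ adj H h h'
  symP : ∀ a b → adjP a b ≡ adjP b a
  symP (g , h) (g' , h') = cong₂ _∧_ (Graph.sym G g g') (Graph.sym H h h')
  irrP : ∀ a → adjP a a ≡ false
  irrP (g , h) rewrite Graph.irrefl G g = refl

module Submission where

-- Write n = n′ + 1 and D = Δ(H).  If D = 0 the product has no edges.  Otherwise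
-- we use two ingredients: a Latin square L of order n with pairwise distinct
-- diagonal entries (the addition table of ℤ/nℤ for odd n, a prolongation of
-- the table of ℤ/(n-1)ℤ for even n ≥ 4), and a proper edge colouring c of H
-- with D colours (König's theorem, proved by Kempe-chain recolouring).  Vertex
-- (g, h) gets L(g, g); an edge (g, h)(g′, h′) with c(hh′) = 0 gets L(g, g′), and
-- one with c(hh′) = j + 1 gets the nonzero difference g′ - g in the j-th block
-- of n′ fresh colours, reading (g, g′) from the endpoint on a fixed side of H.
-- This uses n + (D - 1) n′ = 1 + D n′ ≤ 1 + Δ(K n × H) colours.

open import Defs hiding (sym)
open import Data.Nat using (ℕ; zero; suc; _+_; _*_; _∸_; _≤_; _<_; _⊔_; z≤n; s≤s)
open import Data.Nat.Properties
  using (≤-trans; ≤-refl; ≤-reflexive; <-irrefl; n≤1+n; m≤n+m; m≤m⊔n; m≤n⊔m; ⊔-sel; *-mono-≤; *-comm;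
         +-comm; +-assoc; +-identityʳ; +-suc; m+[n∸m]≡n; <⇒≤; module ≤-Reasoning)
open import Data.Nat.DivMod
  using (_%_; m%n<n; %-distribˡ-+; %-distribˡ-*; m%n%n≡m%n; m<n⇒m%n≡m; [m+kn]%n≡m%n; n%n≡0)
open import Data.Nat.Tactic.RingSolver using (solve-∀)
open import Data.Nat.ListAction using (sum)
open import Data.Fin
  using (Fin; zero; suc; toℕ; fromℕ<; _≟_; punchIn; punchOut; combine; remQuot; _↑ˡ_; _↑ʳ_; splitAt; inject≤)
import Data.Fin.Properties as FinP
open import Data.Fin.Permutation.Components using (transpose; transpose-inverse)
open import Data.Bool using (Bool; true; false; _∧_; _∨_; not; if_then_else_)
import Data.Bool.Properties as BoolP
open import Data.Product using (Σ; ∃; _×_; _,_; proj₁; proj₂; uncurry)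
open import Data.Sum using (_⊎_; inj₁; inj₂)
open import Data.Empty using (⊥-elim)
open import Data.List using (List; []; _∷_; foldr; tabulate; allFin; cartesianProduct)
open import Data.List.Properties using (map-tabulate)
open import Data.List.Membership.Propositional using (_∈_)
open import Data.List.Membership.Propositional.Properties using (∈-allFin; ∈-cartesianProduct⁺)
open import Data.List.Relation.Unary.Any using (here; there)
open import Relation.Nullary using (¬_; Dec; does; yes; no)
open import Relation.Nullary.Decidable using (dec-true; _×-dec_)
open import Relation.Binary.PropositionalEquality
open import Function using (_∘_)
open import Function.Definitions using (Injective)

∧-elim : ∀ {a b} → a ∧ b ≡ true → a ≡ true × b ≡ true
∧-elim {true} e = refl , e

∧-intro : ∀ {a b} → a ≡ true → b ≡ true → a ∧ b ≡ true
∧-intro refl refl = refl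

∨-elim : ∀ {a b} → a ∨ b ≡ true → a ≡ true ⊎ b ≡ true
∨-elim {true}  e = inj₁ refl
∨-elim {false} e = inj₂ e

∨-introˡ : ∀ {a} b → a ≡ true → a ∨ b ≡ true
∨-introˡ b refl = refl

∨-introʳ : ∀ a {b} → b ≡ true → a ∨ b ≡ true
∨-introʳ true  e = refl
∨-introʳ false e = e

true≢false : true ≢ false
true≢false ()

does-true : ∀ {P : Set} (d : Dec P) → does d ≡ true → P
does-true (yes p) _ = p

opposite-not : ∀ {a b : Bool} → a ≢ b → b ≡ not a
opposite-not {true}  {true}  a≢b = ⊥-elim (a≢b refl)
opposite-not {true}  {false} _   = refl
opposite-not {false} {true}  _   = refl
opposite-not {false} {false} a≢b = ⊥-elim (a≢b refl)

opposite-opposite : ∀ {a b c : Bool} → a ≢ b → b ≢ c → a ≡ c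
opposite-opposite {a} a≢b b≢c =
  sym (trans (opposite-not b≢c) (trans (cong not (opposite-not a≢b)) (BoolP.not-involutive a)))

count : (m : ℕ) → (Fin m → Bool) → ℕ
count zero    P = 0
count (suc m) P = (if P zero then 1 else 0) + count m (P ∘ suc)

degree≡count : (G : Graph) (u : Fin (order G)) → degree G u ≡ count (order G) (adj G u)
degree≡count G u =
  trans (cong sum (map-tabulate (λ v → v) indicator)) (sum-indicators (order G) (adj G u))
  where
  indicator : Fin (order G) → ℕ
  indicator v = if adj G u v then 1 else 0
  sum-indicators : ∀ m (P : Fin m → Bool) →
                   sum (tabulate (λ v → if P v then 1 else 0)) ≡ count m P
  sum-indicators zero    P = refl
  sum-indicators (suc m) P = cong ((if P zero then 1 else 0) +_) (sum-indicators m (P ∘ suc))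

count-injection : ∀ m (P : Fin m → Bool) {D} (f : Fin D → Fin m) →
                  Injective _≡_ _≡_ f → (∀ i → P (f i) ≡ true) → D ≤ count m P
count-injection zero    P {zero}  f f-inj f-P = z≤n
count-injection zero    P {suc D} f f-inj f-P with () ← f zero
count-injection (suc m) P {D} f f-inj f-P with FinP.any? (λ i → f i ≟ zero)
... | no zero∉f = ≤-trans (count-injection m (P ∘ suc) f′ f′-inj f′-P) (m≤n+m _ _)
  where
  -- f misses zero, so it factors through suc
  miss : ∀ i → zero ≢ f i
  miss i e = zero∉f (i , sym e)
  f′ : Fin D → Fin m
  f′ i = punchOut (miss i)
  f′-inj : Injective _≡_ _≡_ f′
  f′-inj {i} {j} e = f-inj (FinP.punchOut-injective (miss i) (miss j) e)
  f′-P : ∀ i → P (suc (f′ i)) ≡ true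
  f′-P i = trans (cong P (FinP.punchIn-punchOut (miss i))) (f-P i)
count-injection (suc m) P {suc D} f f-inj f-P | yes (i₀ , fi₀≡0) = P0-counts (f-P i₀)
  where
  -- remove the element i₀ hitting zero; the rest misses zero
  miss : ∀ j → zero ≢ f (punchIn i₀ j)
  miss j e = FinP.punchInᵢ≢i i₀ j (f-inj (trans (sym e) (sym fi₀≡0)))
  f′ : Fin D → Fin m
  f′ j = punchOut (miss j)
  f′-inj : Injective _≡_ _≡_ f′
  f′-inj {i} {j} e = FinP.punchIn-injective i₀ i j (f-inj (FinP.punchOut-injective (miss i) (miss j) e))
  f′-P : ∀ j → P (suc (f′ j)) ≡ true
  f′-P j = trans (cong P (FinP.punchIn-punchOut (miss j))) (f-P (punchIn i₀ j))
  P0-counts : P (f i₀) ≡ true → suc D ≤ count (suc m) P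
  P0-counts Pfi₀ rewrite trans (cong P (sym fi₀≡0)) Pfi₀ =
    s≤s (count-injection m (P ∘ suc) f′ f′-inj f′-P)
count-injection (suc m) P {zero} f f-inj f-P | yes (() , _)

enumerate : ∀ m (P : Fin m → Bool) →
            Σ (Fin (count m P) → Fin m) λ e → Injective _≡_ _≡_ e × (∀ i → P (e i) ≡ true)
enumerate zero    P = (λ ()) , (λ { {()} }) , (λ ())
enumerate (suc m) P with enumerate m (P ∘ suc) | P zero in P0
... | e , e-inj , e-P | false = suc ∘ e , e-inj ∘ FinP.suc-injective , e-P
... | e , e-inj , e-P | true  = e′ , e′-inj , e′-P
  where
  e′ : Fin (suc (count m (P ∘ suc))) → Fin (suc m)
  e′ zero    = zero
  e′ (suc i) = suc (e i)
  e′-inj : Injective _≡_ _≡_ e′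
  e′-inj {zero}  {zero}  _ = refl
  e′-inj {suc i} {suc j} q = cong suc (e-inj (FinP.suc-injective q))
  e′-P : ∀ i → P (e′ i) ≡ true
  e′-P zero    = P0
  e′-P (suc i) = e-P i

count≤ : ∀ m (P : Fin m → Bool) → count m P ≤ m
count≤ zero    P = z≤n
count≤ (suc m) P with P zero
... | true  = s≤s (count≤ m (P ∘ suc))
... | false = ≤-trans (count≤ m (P ∘ suc)) (n≤1+n m)

count-mono : ∀ m (P Q : Fin m → Bool) → (∀ x → P x ≡ true → Q x ≡ true) → count m P ≤ count m Q
count-mono zero    P Q P⊆Q = z≤n
count-mono (suc m) P Q P⊆Q with P zero in P0 | Q zero in Q0
... | true  | true  = s≤s (count-mono m _ _ (P⊆Q ∘ suc))
... | false | true  = ≤-trans (count-mono m _ _ (P⊆Q ∘ suc)) (n≤1+n _)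
... | false | false = count-mono m _ _ (P⊆Q ∘ suc)
... | true  | false with () ← trans (sym (P⊆Q zero P0)) Q0

count-strict : ∀ m (P Q : Fin m → Bool) → (∀ x → P x ≡ true → Q x ≡ true) →
               (y : Fin m) → Q y ≡ true → P y ≡ false → count m P < count m Q
count-strict (suc m) P Q P⊆Q zero Qy Py rewrite Qy | Py = s≤s (count-mono m _ _ (P⊆Q ∘ suc))
count-strict (suc m) P Q P⊆Q (suc y) Qy Py with P zero in P0 | Q zero in Q0
... | true  | true  = s≤s (count-strict m _ _ (P⊆Q ∘ suc) y Qy Py)
... | false | true  = ≤-trans (count-strict m _ _ (P⊆Q ∘ suc) y Qy Py) (n≤1+n _)
... | false | false = count-strict m _ _ (P⊆Q ∘ suc) y Qy Py
... | true  | false with () ← trans (sym (P⊆Q zero P0)) Q0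

module _ {A : Set} (f : A → ℕ) where
  maximum : List A → ℕ
  maximum = foldr (λ x acc → f x ⊔ acc) 0

  maximum-bound : ∀ {x} xs → x ∈ xs → f x ≤ maximum xs
  maximum-bound (y ∷ ys) (here refl) = m≤m⊔n (f y) (maximum ys)
  maximum-bound (y ∷ ys) (there x∈ys) = ≤-trans (maximum-bound ys x∈ys) (m≤n⊔m (f y) (maximum ys))

  maximum-attained : ∀ xs → maximum xs ≡ 0 ⊎ ∃ λ x → f x ≡ maximum xs
  maximum-attained [] = inj₁ refl
  maximum-attained (y ∷ ys) with ⊔-sel (f y) (maximum ys)
  ... | inj₁ e = inj₂ (y , sym e)
  ... | inj₂ e with maximum-attained ys
  ...   | inj₁ z       = inj₁ (trans e z)
  ...   | inj₂ (x , q) = inj₂ (x , trans q (sym e))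

degree≤maxDegree : (G : Graph) (u : Fin (order G)) → degree G u ≤ maxDegree G
degree≤maxDegree G u = maximum-bound (degree G) (allFin (order G)) (∈-allFin u)

maxDegree-attained : (G : Graph) → maxDegree G ≡ 0 ⊎ ∃ λ u → degree G u ≡ maxDegree G
maxDegree-attained G = maximum-attained (degree G) (allFin (order G))

maxDegree0-edgeless : (G : Graph) → maxDegree G ≡ 0 → ∀ u v → ¬ Adj G u v
maxDegree0-edgeless G Δ≡0 u v uv with ≤-trans one-neighbour degree-bound
  where
  one-neighbour : 1 ≤ count (order G) (adj G u)
  one-neighbour = count-injection (order G) (adj G u) (λ _ → v) (λ { {zero} {zero} _ → refl }) (λ _ → uv)
  degree-bound : count (order G) (adj G u) ≤ 0
  degree-bound = ≤-trans (≤-reflexive (sym (degree≡count G u))) (≤-trans (degree≤maxDegree G u) (≤-reflexive Δ≡0))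
... | ()

anyFin : ∀ k → (Fin k → Bool) → Bool
anyFin zero    P = false
anyFin (suc k) P = P zero ∨ anyFin k (P ∘ suc)

anyFin-witness : ∀ k (P : Fin k → Bool) → anyFin k P ≡ true → ∃ λ x → P x ≡ true
anyFin-witness (suc k) P e with ∨-elim {P zero} e
... | inj₁ P0 = zero , P0
... | inj₂ rest with anyFin-witness k (P ∘ suc) rest
...   | x , Px = suc x , Px

anyFin-intro : ∀ k (P : Fin k → Bool) x → P x ≡ true → anyFin k P ≡ true
anyFin-intro (suc k) P zero    Px = ∨-introˡ _ Px
anyFin-intro (suc k) P (suc x) Px = ∨-introʳ (P zero) (anyFin-intro k (P ∘ suc) x Px)


module Cyclic (p : ℕ) where
  infixl 6 _⊕_

  q : ℕ
  q = suc p

  _⊕_ : Fin q → Fin q → Fin q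
  a ⊕ b = fromℕ< (m%n<n (toℕ a + toℕ b) q)

  ⊖_ : Fin q → Fin q
  ⊖ a = fromℕ< (m%n<n (q ∸ toℕ a) q)

  toℕ-⊕ : ∀ a b → toℕ (a ⊕ b) ≡ (toℕ a + toℕ b) % q
  toℕ-⊕ a b = FinP.toℕ-fromℕ< _

  ≡-mod : ∀ a b → toℕ a % q ≡ toℕ b % q → a ≡ b
  ≡-mod a b e = FinP.toℕ-injective (trans (sym (reduced a)) (trans e (reduced b)))
    where
    reduced : ∀ (c : Fin q) → toℕ c % q ≡ toℕ c
    reduced c = m<n⇒m%n≡m (FinP.toℕ<n c)

  %-absorbˡ : ∀ x y → (x % q + y) % q ≡ (x + y) % q
  %-absorbˡ x y = begin
    (x % q + y) % q         ≡⟨ %-distribˡ-+ (x % q) y q ⟩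
    (x % q % q + y % q) % q ≡⟨ cong (λ z → (z + y % q) % q) (m%n%n≡m%n x q) ⟩
    (x % q + y % q) % q     ≡⟨ %-distribˡ-+ x y q ⟨
    (x + y) % q             ∎
    where open ≡-Reasoning

  %-absorbʳ : ∀ x y → (x + y % q) % q ≡ (x + y) % q
  %-absorbʳ x y = begin
    (x + y % q) % q ≡⟨ cong (_% q) (+-comm x (y % q)) ⟩
    (y % q + x) % q ≡⟨ %-absorbˡ y x ⟩
    (y + x) % q     ≡⟨ cong (_% q) (+-comm y x) ⟩
    (x + y) % q     ∎
    where open ≡-Reasoning

  %-absorb-* : ∀ x y → (x % q * y) % q ≡ (x * y) % q
  %-absorb-* x y = begin
    (x % q * y) % q             ≡⟨ %-distribˡ-* (x % q) y q ⟩
    (x % q % q * (y % q)) % q   ≡⟨ cong (λ z → (z * (y % q)) % q) (m%n%n≡m%n x q) ⟩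
    (x % q * (y % q)) % q       ≡⟨ %-distribˡ-* x y q ⟨
    (x * y) % q                 ∎
    where open ≡-Reasoning

  ⊕-comm : ∀ a b → a ⊕ b ≡ b ⊕ a
  ⊕-comm a b = FinP.toℕ-injective (begin
    toℕ (a ⊕ b)           ≡⟨ toℕ-⊕ a b ⟩
    (toℕ a + toℕ b) % q   ≡⟨ cong (_% q) (+-comm (toℕ a) (toℕ b)) ⟩
    (toℕ b + toℕ a) % q   ≡⟨ toℕ-⊕ b a ⟨
    toℕ (b ⊕ a)           ∎)
    where open ≡-Reasoning

  ⊕-assoc : ∀ a b c → (a ⊕ b) ⊕ c ≡ a ⊕ (b ⊕ c)
  ⊕-assoc a b c = FinP.toℕ-injective (begin
    toℕ ((a ⊕ b) ⊕ c)                  ≡⟨ toℕ-⊕ (a ⊕ b) c ⟩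
    (toℕ (a ⊕ b) + toℕ c) % q          ≡⟨ cong (λ x → (x + toℕ c) % q) (toℕ-⊕ a b) ⟩
    ((toℕ a + toℕ b) % q + toℕ c) % q  ≡⟨ %-absorbˡ (toℕ a + toℕ b) (toℕ c) ⟩
    (toℕ a + toℕ b + toℕ c) % q        ≡⟨ cong (_% q) (+-assoc (toℕ a) (toℕ b) (toℕ c)) ⟩
    (toℕ a + (toℕ b + toℕ c)) % q      ≡⟨ %-absorbʳ (toℕ a) (toℕ b + toℕ c) ⟨
    (toℕ a + (toℕ b + toℕ c) % q) % q  ≡⟨ cong (λ x → (toℕ a + x) % q) (toℕ-⊕ b c) ⟨
    (toℕ a + toℕ (b ⊕ c)) % q          ≡⟨ toℕ-⊕ a (b ⊕ c) ⟨
    toℕ (a ⊕ (b ⊕ c))                  ∎)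
    where open ≡-Reasoning

  ⊕-identityʳ : ∀ a → a ⊕ zero ≡ a
  ⊕-identityʳ a = ≡-mod _ _ (begin
    toℕ (a ⊕ zero) % q        ≡⟨ cong (_% q) (toℕ-⊕ a zero) ⟩
    (toℕ a + 0) % q % q       ≡⟨ m%n%n≡m%n (toℕ a + 0) q ⟩
    (toℕ a + 0) % q           ≡⟨ cong (_% q) (+-identityʳ (toℕ a)) ⟩
    toℕ a % q                 ∎)
    where open ≡-Reasoning

  ⊕-inverseʳ : ∀ a → a ⊕ (⊖ a) ≡ zero
  ⊕-inverseʳ a = FinP.toℕ-injective (begin
    toℕ (a ⊕ (⊖ a))                ≡⟨ toℕ-⊕ a (⊖ a) ⟩
    (toℕ a + toℕ (⊖ a)) % q        ≡⟨ cong (λ x → (toℕ a + x) % q) (FinP.toℕ-fromℕ< _) ⟩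
    (toℕ a + (q ∸ toℕ a) % q) % q  ≡⟨ %-absorbʳ (toℕ a) (q ∸ toℕ a) ⟩
    (toℕ a + (q ∸ toℕ a)) % q      ≡⟨ cong (_% q) (m+[n∸m]≡n (<⇒≤ (FinP.toℕ<n a))) ⟩
    q % q                          ≡⟨ n%n≡0 q ⟩
    0                              ∎)
    where open ≡-Reasoning

  ⊕-cancelˡ : ∀ a b c → a ⊕ b ≡ a ⊕ c → b ≡ c
  ⊕-cancelˡ a b c e = begin
    b                  ≡⟨ unfold b ⟩
    (b ⊕ a) ⊕ (⊖ a)    ≡⟨ cong (_⊕ (⊖ a)) (trans (⊕-comm b a) (trans e (⊕-comm a c))) ⟩
    (c ⊕ a) ⊕ (⊖ a)    ≡⟨ unfold c ⟨
    c                  ∎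
    where
    open ≡-Reasoning
    unfold : ∀ x → x ≡ (x ⊕ a) ⊕ (⊖ a)
    unfold x = sym (trans (⊕-assoc x a (⊖ a)) (trans (cong (x ⊕_) (⊕-inverseʳ a)) (⊕-identityʳ x)))

  ⊕-cancelʳ : ∀ a b c → a ⊕ c ≡ b ⊕ c → a ≡ b
  ⊕-cancelʳ a b c e = ⊕-cancelˡ c a b (trans (⊕-comm c a) (trans e (⊕-comm b c)))

  ⊖-injective : ∀ a b → ⊖ a ≡ ⊖ b → a ≡ b
  ⊖-injective a b e = ⊕-cancelʳ a b (⊖ b) (trans (cong (a ⊕_) (sym e)) (trans (⊕-inverseʳ a) (sym (⊕-inverseʳ b))))

-- 2(t + 1) ≡ 1 modulo 2t + 1, as an identity of natural numbers.
halving-identity : ∀ x t → (x + x) * suc t ≡ x + x * suc (t + t)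
halving-identity = solve-∀

-- In a cyclic group of odd order doubling is injective, since
-- x ≡ (x + x)(t + 1) modulo 2t + 1.
module OddCyclic (t : ℕ) where
  open Cyclic (t + t) public

  double-injective : ∀ a b → a ⊕ a ≡ b ⊕ b → a ≡ b
  double-injective a b e = ≡-mod a b (begin
    toℕ a % q                            ≡⟨ halve (toℕ a) ⟩
    ((toℕ a + toℕ a) % q * suc t) % q    ≡⟨ cong (λ x → (x * suc t) % q) doubles-agree ⟩
    ((toℕ b + toℕ b) % q * suc t) % q    ≡⟨ halve (toℕ b) ⟨
    toℕ b % q                            ∎)
    where
    open ≡-Reasoning
    doubles-agree : (toℕ a + toℕ a) % q ≡ (toℕ b + toℕ b) % q
    doubles-agree = trans (sym (toℕ-⊕ a a)) (trans (cong toℕ e) (toℕ-⊕ b b))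
    halve : ∀ x → x % q ≡ ((x + x) % q * suc t) % q
    halve x = begin
      x % q                      ≡⟨ [m+kn]%n≡m%n x x q ⟨
      (x + x * q) % q            ≡⟨ cong (_% q) (halving-identity x t) ⟨
      ((x + x) * suc t) % q      ≡⟨ %-absorb-* (x + x) (suc t) ⟨
      ((x + x) % q * suc t) % q  ∎

record DiagonalLatinSquare (n : ℕ) : Set where
  field
    L : Fin n → Fin n → Fin n
    row-injective      : ∀ a b b′ → L a b ≡ L a b′ → b ≡ b′
    column-injective   : ∀ a a′ b → L a b ≡ L a′ b → a ≡ a′
    diagonal-injective : ∀ a b → L a a ≡ L b b → a ≡ b

cyclicSquare : ∀ t → DiagonalLatinSquare (suc (t + t))
cyclicSquare t = record
  { L = _⊕_ ; row-injective = ⊕-cancelˡ ; column-injective = ⊕-cancelʳ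
  ; diagonal-injective = double-injective }
  where open OddCyclic t

-- Even order q + 1 with q = 2s + 3: prolong the addition table of ℤ/qℤ by a
-- new symbol ∞ (the index zero of Fin (suc q)).  The cells (i, i+1) of the
-- table receive ∞, and their old entries i + (i+1) are moved to the new row
-- and column.  The diagonal is then 2i for i in ℤ/qℤ together with ∞.
module Prolongation (s : ℕ) where
  open OddCyclic (suc s)

  one : Fin q
  one = suc zero

  next prev : Fin q → Fin q
  next i = i ⊕ one
  prev j = j ⊕ (⊖ one)

  next-prev : ∀ j → next (prev j) ≡ j
  next-prev j = begin
    (j ⊕ (⊖ one)) ⊕ one  ≡⟨ ⊕-assoc j (⊖ one) one ⟩
    j ⊕ ((⊖ one) ⊕ one)  ≡⟨ cong (j ⊕_) (trans (⊕-comm (⊖ one) one) (⊕-inverseʳ one)) ⟩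
    j ⊕ zero             ≡⟨ ⊕-identityʳ j ⟩
    j                    ∎
    where open ≡-Reasoning

  next-injective : ∀ i i′ → next i ≡ next i′ → i ≡ i′
  next-injective i i′ = ⊕-cancelʳ i i′ one

  next-moves : ∀ i → next i ≢ i
  next-moves i e with () ← ⊕-cancelˡ i one zero (trans e (sym (⊕-identityʳ i)))

  -- the entry displaced from cell (i, next i)
  displaced : Fin q → Fin q
  displaced i = i ⊕ next i

  displaced-injective : ∀ i i′ → displaced i ≡ displaced i′ → i ≡ i′
  displaced-injective i i′ e = double-injective i i′ (⊕-cancelʳ _ _ one (begin
    (i ⊕ i) ⊕ one      ≡⟨ ⊕-assoc i i one ⟩
    displaced i        ≡⟨ e ⟩
    displaced i′       ≡⟨ ⊕-assoc i′ i′ one ⟨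
    (i′ ⊕ i′) ⊕ one    ∎))
    where open ≡-Reasoning

  displaced-prev : ∀ j → displaced (prev j) ≡ prev j ⊕ j
  displaced-prev j = cong (prev j ⊕_) (next-prev j)

  -- a cell (i, j) of the old table that is not moved keeps its entry
  kept≢displaced : ∀ i j → j ≢ next i → prev j ⊕ j ≢ i ⊕ j
  kept≢displaced i j j≢next e = j≢next (trans (sym (next-prev j)) (cong next (⊕-cancelʳ (prev j) i j e)))

  inner : (i j : Fin q) → Dec (j ≡ next i) → Fin (suc q)
  inner i j (yes _) = zero
  inner i j (no _)  = suc (i ⊕ j)

  L : Fin (suc q) → Fin (suc q) → Fin (suc q)
  L zero    zero    = zero
  L zero    (suc j) = suc (displaced (prev j))
  L (suc i) zero    = suc (displaced i)
  L (suc i) (suc j) = inner i j (j ≟ next i)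

  row-injective : ∀ a b b′ → L a b ≡ L a b′ → b ≡ b′
  row-injective zero zero    zero     e = refl
  row-injective zero (suc j) (suc j′) e = cong suc (begin
    j                   ≡⟨ next-prev j ⟨
    next (prev j)       ≡⟨ cong next (displaced-injective (prev j) (prev j′) (FinP.suc-injective e)) ⟩
    next (prev j′)      ≡⟨ next-prev j′ ⟩
    j′                  ∎)
    where open ≡-Reasoning
  row-injective (suc i) zero zero e = refl
  row-injective (suc i) zero (suc j′) e with j′ ≟ next i
  ... | no j′≢next = ⊥-elim (j′≢next (sym (⊕-cancelˡ i _ _ (FinP.suc-injective e))))
  row-injective (suc i) (suc j) zero e with j ≟ next i
  ... | no j≢next = ⊥-elim (j≢next (⊕-cancelˡ i _ _ (FinP.suc-injective e)))
  row-injective (suc i) (suc j) (suc j′) e with j ≟ next i | j′ ≟ next i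
  ... | yes p | yes p′ = cong suc (trans p (sym p′))
  ... | no _  | no _   = cong suc (⊕-cancelˡ i j j′ (FinP.suc-injective e))

  column-injective : ∀ a a′ b → L a b ≡ L a′ b → a ≡ a′
  column-injective zero zero b e = refl
  column-injective zero (suc i) (suc j) e with j ≟ next i
  ... | no j≢next = ⊥-elim (kept≢displaced i j j≢next (trans (sym (displaced-prev j)) (FinP.suc-injective e)))
  column-injective (suc i) zero (suc j) e with j ≟ next i
  ... | no j≢next = ⊥-elim (kept≢displaced i j j≢next (trans (sym (displaced-prev j)) (sym (FinP.suc-injective e))))
  column-injective (suc i) (suc i′) zero e = cong suc (displaced-injective i i′ (FinP.suc-injective e))
  column-injective (suc i) (suc i′) (suc j) e with j ≟ next i | j ≟ next i′
  ... | yes p | yes p′ = cong suc (next-injective i i′ (trans (sym p) p′))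
  ... | no _  | no _   = cong suc (⊕-cancelʳ i i′ j (FinP.suc-injective e))

  -- diagonal cells (i, i) are never moved, since next i ≢ i
  diagonal-injective : ∀ a b → L a a ≡ L b b → a ≡ b
  diagonal-injective zero zero e = refl
  diagonal-injective zero (suc b) e with b ≟ next b
  ... | yes p = ⊥-elim (next-moves b (sym p))
  diagonal-injective (suc a) zero e with a ≟ next a
  ... | yes p = ⊥-elim (next-moves a (sym p))
  diagonal-injective (suc a) (suc b) e with a ≟ next a | b ≟ next b
  ... | yes p | _     = ⊥-elim (next-moves a (sym p))
  ... | no _  | yes p = ⊥-elim (next-moves b (sym p))
  ... | no _  | no _  = cong suc (double-injective a b (FinP.suc-injective e))

  prolongedSquare : DiagonalLatinSquare (suc q)
  prolongedSquare = record
    { L = L ; row-injective = row-injective ; column-injective = column-injective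
    ; diagonal-injective = diagonal-injective }

parity : ∀ n → (Σ ℕ λ t → n ≡ t + t) ⊎ (Σ ℕ λ t → n ≡ suc (t + t))
parity zero = inj₁ (0 , refl)
parity (suc n) with parity n
... | inj₁ (t , e) = inj₂ (t , cong suc e)
... | inj₂ (t , e) = inj₁ (suc t , trans (cong suc e) (cong suc (sym (+-suc t t))))

diagonalLatinSquare : ∀ n → n ≢ 0 → n ≢ 2 → DiagonalLatinSquare n
diagonalLatinSquare n n≢0 n≢2 with parity n
... | inj₂ (t , refl)             = cyclicSquare t
... | inj₁ (zero , refl)          = ⊥-elim (n≢0 refl)
... | inj₁ (suc zero , refl)      = ⊥-elim (n≢2 refl)
... | inj₁ (suc (suc s) , refl)   = subst DiagonalLatinSquare (sym (cong suc (+-suc (suc s) (suc s))))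
                                          (Prolongation.prolongedSquare s)

module _ {D} (α β : Fin D) where
  transpose-pair : ∀ γ → (γ ≡ α ⊎ γ ≡ β) → (transpose α β γ ≡ α ⊎ transpose α β γ ≡ β)
  transpose-pair γ h with does (γ ≟ α)
  ... | true = inj₂ refl
  ... | false with does (γ ≟ β)
  ...   | true  = inj₁ refl
  ...   | false = h

  transpose-to-α : ∀ γ → transpose α β γ ≡ α → γ ≡ β
  transpose-to-α γ e with γ ≟ α
  ... | yes refl = sym e
  ... | no γ≢α with γ ≟ β
  ...   | yes γ≡β = γ≡β
  ...   | no _    = ⊥-elim (γ≢α e)

  transpose-injective : Injective _≡_ _≡_ (transpose α β)
  transpose-injective {γ} {δ} e = begin
    γ                             ≡⟨ transpose-inverse β α ⟨
    transpose β α (transpose α β γ) ≡⟨ cong (transpose β α) e ⟩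
    transpose β α (transpose α β δ) ≡⟨ transpose-inverse β α ⟩
    δ                             ∎
    where open ≡-Reasoning

record EdgeColouring (m D : ℕ) (R : Fin m → Fin m → Set) : Set where
  field
    colour     : Fin m → Fin m → Fin D
    colour-sym : ∀ x y → colour x y ≡ colour y x
    proper     : ∀ x y z → R x y → R x z → y ≢ z → colour x y ≢ colour x z

restrict : ∀ {m D} {R R′ : Fin m → Fin m → Set} → (∀ x y → R x y → R′ x y) →
           EdgeColouring m D R′ → EdgeColouring m D R
restrict R⊆R′ c = record
  { colour = colour ; colour-sym = colour-sym
  ; proper = λ x y z r r′ → proper x y z (R⊆R′ _ _ r) (R⊆R′ _ _ r′) }
  where open EdgeColouring c

-- Edges are added one at a
-- time; a new edge uv is coloured after swapping two colours along a Kempe chain.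
module BipartiteEdgeColouring (H : Graph) (side : Fin (order H) → Bool)
  (bipartite : ∀ u v → Adj H u v → side u ≢ side v)
  (D : ℕ) (degree≤D : ∀ w → count (order H) (adj H w) ≤ D) (someColour : Fin D) where

  m : ℕ
  m = order H

  V : Set
  V = Fin m

  eqB : V → V → Bool
  eqB x y = does (x ≟ y)

  Pair : V → V → V → V → Set
  Pair a b x y = (x ≡ a × y ≡ b) ⊎ (x ≡ b × y ≡ a)

  pair : V → V → V → V → Bool
  pair a b x y = (eqB x a ∧ eqB y b) ∨ (eqB x b ∧ eqB y a)

  pair-sym : ∀ a b x y → pair a b x y ≡ pair a b y x
  pair-sym a b x y =
    trans (BoolP.∨-comm (eqB x a ∧ eqB y b) (eqB x b ∧ eqB y a))
          (cong₂ _∨_ (BoolP.∧-comm (eqB x b) (eqB y a)) (BoolP.∧-comm (eqB x a) (eqB y b)))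

  pair-sound : ∀ a b x y → pair a b x y ≡ true → Pair a b x y
  pair-sound a b x y e with ∨-elim {eqB x a ∧ eqB y b} e
  ... | inj₁ p = let p₁ , p₂ = ∧-elim {eqB x a} p in inj₁ (does-true (x ≟ a) p₁ , does-true (y ≟ b) p₂)
  ... | inj₂ p = let p₁ , p₂ = ∧-elim {eqB x b} p in inj₂ (does-true (x ≟ b) p₁ , does-true (y ≟ a) p₂)

  pair-complete : ∀ a b x y → Pair a b x y → pair a b x y ≡ true
  pair-complete a b x y (inj₁ (refl , refl)) = ∨-introˡ _ (∧-intro (dec-true (x ≟ x) refl) (dec-true (y ≟ y) refl))
  pair-complete a b x y (inj₂ (refl , refl)) = ∨-introʳ (eqB x y ∧ eqB y x) (∧-intro (dec-true (x ≟ x) refl) (dec-true (y ≟ y) refl))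

  module AddEdge (E : V → V → Bool) (E-sym : ∀ x y → E x y ≡ E y x)
    (E⊆H : ∀ x y → E x y ≡ true → Adj H x y)
    (pc : EdgeColouring m D (λ x y → E x y ≡ true))
    (u v : V) (uv∈H : Adj H u v) (uv∉E : E u v ≡ false) where
    open EdgeColouring pc

    seen? : ∀ w γ → Dec (∃ λ y → E w y ≡ true × colour w y ≡ γ)
    seen? w γ = FinP.any? (λ y → (E w y BoolP.≟ true) ×-dec (colour w y ≟ γ))

    -- A vertex w with an edge of H outside E sees fewer than D colours in E:
    -- otherwise its E-neighbours of each colour together with z would be
    -- D + 1 distinct neighbours.
    freeColour : ∀ w z → Adj H w z → E w z ≡ false →
                 Σ (Fin D) λ γ → ∀ y → E w y ≡ true → colour w y ≢ γ
    freeColour w z wz∈H wz∉E with FinP.all? (seen? w)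
    ... | no some-unseen =
      let γ , unseen = FinP.¬∀⟶∃¬ D _ (seen? w) some-unseen
      in γ , λ y wy∈E wy≡γ → unseen (y , wy∈E , wy≡γ)
    ... | yes all-seen = ⊥-elim (<-irrefl refl (≤-trans (count-injection m (adj H w) f f-inj f-adj) (degree≤D w)))
      where
      f : Fin (suc D) → V
      f zero    = z
      f (suc γ) = proj₁ (all-seen γ)
      f≢z : ∀ γ → proj₁ (all-seen γ) ≢ z
      f≢z γ e with () ← trans (sym (proj₁ (proj₂ (all-seen γ)))) (trans (cong (E w) e) wz∉E)
      f-inj : Injective _≡_ _≡_ f
      f-inj {zero}  {zero}   _ = refl
      f-inj {zero}  {suc γ}  e = ⊥-elim (f≢z γ (sym e))
      f-inj {suc γ} {zero}   e = ⊥-elim (f≢z γ e)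
      f-inj {suc γ} {suc γ′} e = cong suc (begin
        γ                               ≡⟨ proj₂ (proj₂ (all-seen γ)) ⟨
        colour w (proj₁ (all-seen γ))   ≡⟨ cong (colour w) e ⟩
        colour w (proj₁ (all-seen γ′))  ≡⟨ proj₂ (proj₂ (all-seen γ′)) ⟩
        γ′                              ∎)
        where open ≡-Reasoning
      f-adj : ∀ i → adj H w (f i) ≡ true
      f-adj zero    = wz∈H
      f-adj (suc γ) = E⊆H w _ (proj₁ (proj₂ (all-seen γ)))

    vu∈H : Adj H v u
    vu∈H = trans (Graph.sym H v u) uv∈H

    vu∉E : E v u ≡ false
    vu∉E = trans (E-sym v u) uv∉E

    α β : Fin D
    α = proj₁ (freeColour u v uv∈H uv∉E)
    β = proj₁ (freeColour v u vu∈H vu∉E)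

    α-free-at-u : ∀ y → E u y ≡ true → colour u y ≢ α
    α-free-at-u = proj₂ (freeColour u v uv∈H uv∉E)

    β-free-at-v : ∀ y → E v y ≡ true → colour v y ≢ β
    β-free-at-v = proj₂ (freeColour v u vu∈H vu∉E)

    isαβ : Fin D → Bool
    isαβ γ = does (γ ≟ α) ∨ does (γ ≟ β)

    isαβ-sound : ∀ γ → isαβ γ ≡ true → γ ≡ α ⊎ γ ≡ β
    isαβ-sound γ e with ∨-elim {does (γ ≟ α)} e
    ... | inj₁ p = inj₁ (does-true (γ ≟ α) p)
    ... | inj₂ p = inj₂ (does-true (γ ≟ β) p)

    isαβ-complete : ∀ γ → γ ≡ α ⊎ γ ≡ β → isαβ γ ≡ true
    isαβ-complete γ (inj₁ γ≡α) = ∨-introˡ _ (dec-true (γ ≟ α) γ≡α)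
    isαβ-complete γ (inj₂ γ≡β) = ∨-introʳ (does (γ ≟ α)) (dec-true (γ ≟ β) γ≡β)

    chainEdge : V → V → Bool
    chainEdge x y = E x y ∧ isαβ (colour x y)

    chainEdge-sym : ∀ x y → chainEdge x y ≡ chainEdge y x
    chainEdge-sym x y = cong₂ (λ e γ → e ∧ isαβ γ) (E-sym x y) (colour-sym x y)

    reach : ℕ → V → Bool
    reach zero    x = eqB x v
    reach (suc k) x = reach k x ∨ anyFin m (λ y → reach k y ∧ chainEdge y x)

    reach-suc : ∀ k x → reach k x ≡ true → reach (suc k) x ≡ true
    reach-suc k x = ∨-introˡ _

    reach-step : ∀ k x y → reach k x ≡ true → chainEdge x y ≡ true → reach (suc k) y ≡ true
    reach-step k x y rx xy = ∨-introʳ (reach k y) (anyFin-intro m (λ x′ → reach k x′ ∧ chainEdge x′ y) x (∧-intro rx xy))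

    reach-v : ∀ k → reach k v ≡ true
    reach-v zero    = dec-true (v ≟ v) refl
    reach-v (suc k) = reach-suc k v (reach-v k)

    colour-determines : ∀ x y z → E x y ≡ true → E x z ≡ true → colour x y ≡ colour x z → y ≡ z
    colour-determines x y z xy∈E xz∈E e with y ≟ z
    ... | yes y≡z = y≡z
    ... | no  y≢z = ⊥-elim (proper x y z xy∈E xz∈E y≢z e)

    -- The chain alternates sides, and since β is free at v it leaves v by an
    -- α-edge.  Hence a reached vertex y on the side of v has its β-partner
    -- reached, and a reached vertex on the other side has an α-edge, whose
    -- endpoint is reached.
    ChainInvariant : ℕ → V → Set
    ChainInvariant k y =
      (side y ≡ side v → y ≢ v → ∀ z → E y z ≡ true → colour y z ≡ β → reach k z ≡ true) ×
      (side y ≢ side v → (∃ λ z → E y z ≡ true × colour y z ≡ α) ×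
                         (∀ z → E y z ≡ true → colour y z ≡ α → reach k z ≡ true))

    invariant-suc : ∀ k y → ChainInvariant k y → ChainInvariant (suc k) y
    invariant-suc k y (same-side , other-side) =
      (λ s y≢v z yz∈E yz≡β → reach-suc k z (same-side s y≢v z yz∈E yz≡β)) ,
      (λ s → proj₁ (other-side s) , λ z yz∈E yz≡α → reach-suc k z (proj₂ (other-side s) z yz∈E yz≡α))

    partner-reached : ∀ k y z γ → E y z ≡ true → colour y z ≡ γ → reach k z ≡ true →
                      ∀ z′ → E y z′ ≡ true → colour y z′ ≡ γ → reach (suc k) z′ ≡ true
    partner-reached k y z γ yz∈E yz≡γ rz z′ yz′∈E yz′≡γ =
      subst (λ w → reach (suc k) w ≡ true) (colour-determines y z z′ yz∈E yz′∈E (trans yz≡γ (sym yz′≡γ)))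
            (reach-suc k z rz)

    extend : ∀ k y₀ y → (∀ x → reach k x ≡ true → ChainInvariant k x) →
             reach k y₀ ≡ true → E y₀ y ≡ true → colour y₀ y ≡ α ⊎ colour y₀ y ≡ β →
             ChainInvariant (suc k) y
    extend k y₀ y inv r₀ y₀y∈E y₀y-αβ with side y₀ BoolP.≟ side v | inv y₀ r₀
    ... | yes s₀ | same-side , _ = case y₀y-αβ
      where
      opposite : side y ≢ side v
      opposite s = bipartite y₀ y (E⊆H y₀ y y₀y∈E) (trans s₀ (sym s))
      yy₀∈E : E y y₀ ≡ true
      yy₀∈E = trans (E-sym y y₀) y₀y∈E
      case : colour y₀ y ≡ α ⊎ colour y₀ y ≡ β → ChainInvariant (suc k) y
      case (inj₁ y₀y≡α) =
        (λ s → ⊥-elim (opposite s)) ,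
        (λ _ → let yy₀≡α = trans (colour-sym y y₀) y₀y≡α in
               (y₀ , yy₀∈E , yy₀≡α) , partner-reached k y y₀ α yy₀∈E yy₀≡α r₀)
      case (inj₂ y₀y≡β) with y₀ ≟ v
      ... | yes refl = ⊥-elim (β-free-at-v y y₀y∈E y₀y≡β)
      ... | no y₀≢v  = invariant-suc k y (inv y (same-side s₀ y₀≢v y y₀y∈E y₀y≡β))
    ... | no s₀ | _ , other-side = case y₀y-αβ
      where
      same : side y ≡ side v
      same = opposite-opposite (bipartite y y₀ (E⊆H y y₀ (trans (E-sym y y₀) y₀y∈E))) s₀
      yy₀∈E : E y y₀ ≡ true
      yy₀∈E = trans (E-sym y y₀) y₀y∈E
      case : colour y₀ y ≡ α ⊎ colour y₀ y ≡ β → ChainInvariant (suc k) y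
      case (inj₁ y₀y≡α) = invariant-suc k y (inv y (proj₂ (other-side s₀) y y₀y∈E y₀y≡α))
      case (inj₂ y₀y≡β) =
        (λ _ _ → partner-reached k y y₀ β yy₀∈E (trans (colour-sym y y₀) y₀y≡β) r₀) ,
        (λ s → ⊥-elim (s same))

    invariant : ∀ k y → reach k y ≡ true → ChainInvariant k y
    invariant zero y r with does-true (y ≟ v) r
    ... | refl = (λ _ v≢v → ⊥-elim (v≢v refl)) , (λ s → ⊥-elim (s refl))
    invariant (suc k) y r with ∨-elim {reach k y} r
    ... | inj₁ r′ = invariant-suc k y (invariant k y r′)
    ... | inj₂ new with anyFin-witness m (λ y₀ → reach k y₀ ∧ chainEdge y₀ y) new
    ...   | y₀ , q with ∧-elim {reach k y₀} q
    ...   | r₀ , edge with ∧-elim {E y₀ y} edge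
    ...   | y₀y∈E , αβ = extend k y₀ y (invariant k) r₀ y₀y∈E (isαβ-sound (colour y₀ y) αβ)

    -- u lies opposite to v and α is free at u, so u is never reached.
    u-unreached : ∀ k → reach k u ≢ true
    u-unreached k r with proj₂ (invariant k u r) (bipartite u v uv∈H)
    ... | (z , uz∈E , uz≡α) , _ = α-free-at-u z uz∈E uz≡α

    Closed : ℕ → Set
    Closed k = ∀ x y → reach k x ≡ true → chainEdge x y ≡ true → reach k y ≡ true

    closed-suc : ∀ k → Closed k → Closed (suc k)
    closed-suc k closed x y rx xy = reach-suc k y (closed x y (back x rx) xy)
      where
      back : ∀ x → reach (suc k) x ≡ true → reach k x ≡ true
      back x r with ∨-elim {reach k x} r
      ... | inj₁ r′  = r′
      ... | inj₂ new with anyFin-witness m (λ y₀ → reach k y₀ ∧ chainEdge y₀ x) new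
      ...   | y₀ , q = let r₀ , y₀x = ∧-elim {reach k y₀} q in closed y₀ x r₀ y₀x

    closed-or-large : ∀ k → Closed k ⊎ suc k ≤ count m (reach k)
    closed-or-large zero =
      inj₂ (count-injection m (reach zero) (λ _ → v) (λ { {zero} {zero} _ → refl }) (λ _ → reach-v zero))
    closed-or-large (suc k) with closed-or-large k
    ... | inj₁ closed = inj₁ (closed-suc k closed)
    ... | inj₂ large with anyFin m (λ y → reach (suc k) y ∧ not (reach k y)) in grows
    ...   | true with anyFin-witness m _ grows
    ...   | y , q with ∧-elim {reach (suc k) y} q
    ...   | r₁ , ¬r = inj₂ (≤-trans (s≤s large) (count-strict m (reach k) (reach (suc k)) (reach-suc k) y r₁ (not-true ¬r)))
      where
      not-true : ∀ {b} → not b ≡ true → b ≡ false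
      not-true {false} _ = refl
    closed-or-large (suc k) | inj₂ large | false = inj₁ (closed-suc k closed)
      where
      -- a chain edge leaving the reached set would reach a new vertex
      closed : Closed k
      closed x y rx xy with reach k y in ry
      ... | true  = refl
      ... | false with () ← trans (sym (anyFin-intro m _ y (∧-intro (reach-step k x y rx xy) (cong not ry)))) grows

    -- After m steps the reached set is closed: it is the whole Kempe chain of v.
    onChain : V → Bool
    onChain = reach m

    chain-closed : Closed m
    chain-closed with closed-or-large m
    ... | inj₁ closed = closed
    ... | inj₂ large  = ⊥-elim (<-irrefl refl (≤-trans large (count≤ m (reach m))))

    swapped : V → V → Bool
    swapped x y = onChain x ∧ chainEdge x y

    no-exit : ∀ x y → onChain x ≡ true → onChain y ≡ false → chainEdge x y ≡ false
    no-exit x y rx ry with chainEdge x y in xy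
    ... | false = refl
    ... | true with () ← trans (sym (chain-closed x y rx xy)) ry

    swapped-sym : ∀ x y → swapped x y ≡ swapped y x
    swapped-sym x y with onChain x in rx | onChain y in ry
    ... | true  | true  = chainEdge-sym x y
    ... | false | false = refl
    ... | true  | false = no-exit x y rx ry
    ... | false | true  = sym (no-exit y x ry rx)

    unswapped-not-αβ : ∀ x z → onChain x ≡ true → E x z ≡ true → swapped x z ≡ false →
                       isαβ (colour x z) ≢ true
    unswapped-not-αβ x z rx xz∈E unswapped αβ =
      true≢false (trans (sym (∧-intro rx (∧-intro xz∈E αβ))) unswapped)

    swapped-αβ : ∀ x y → swapped x y ≡ true → isαβ (transpose α β (colour x y)) ≡ true
    swapped-αβ x y s = isαβ-complete _ (transpose-pair α β (colour x y)
                         (isαβ-sound _ (proj₂ (∧-elim {E x y} (proj₂ (∧-elim {onChain x} s))))))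

    colour′ : V → V → Fin D
    colour′ x y = if swapped x y then transpose α β (colour x y) else colour x y

    colour′-sym : ∀ x y → colour′ x y ≡ colour′ y x
    colour′-sym x y rewrite swapped-sym x y | colour-sym x y = refl

    colour′-proper : ∀ x y z → E x y ≡ true → E x z ≡ true → y ≢ z → colour′ x y ≢ colour′ x z
    colour′-proper x y z xy∈E xz∈E y≢z with swapped x y in sy | swapped x z in sz
    ... | true  | true  = proper x y z xy∈E xz∈E y≢z ∘ transpose-injective α β
    ... | false | false = proper x y z xy∈E xz∈E y≢z
    ... | true  | false = λ e → unswapped-not-αβ x z (proj₁ (∧-elim {onChain x} sy)) xz∈E sz
                                  (trans (sym (cong isαβ e)) (swapped-αβ x y sy))
    ... | false | true  = λ e → unswapped-not-αβ x y (proj₁ (∧-elim {onChain x} sz)) xy∈E sy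
                                  (trans (cong isαβ e) (swapped-αβ x z sz))

    α-free-at-v′ : ∀ y → E v y ≡ true → colour′ v y ≢ α
    α-free-at-v′ y vy∈E with swapped v y in s
    ... | true  = β-free-at-v y vy∈E ∘ transpose-to-α α β (colour v y)
    ... | false = λ vy≡α → unswapped-not-αβ v y (reach-v m) vy∈E s (isαβ-complete _ (inj₁ vy≡α))

    α-free-at-u′ : ∀ y → E u y ≡ true → colour′ u y ≢ α
    α-free-at-u′ y uy∈E with swapped u y in s
    ... | true  = ⊥-elim (u-unreached m (proj₁ (∧-elim {onChain u} s)))
    ... | false = α-free-at-u y uy∈E

    colour″ : V → V → Fin D
    colour″ x y = if pair u v x y then α else colour′ x y

    colour″-sym : ∀ x y → colour″ x y ≡ colour″ y x
    colour″-sym x y rewrite pair-sym u v x y | colour′-sym x y = refl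

    u≢v : u ≢ v
    u≢v refl with () ← trans (sym uv∈H) (Graph.irrefl H u)

    old-edge : ∀ x y → E x y ≡ true → colour″ x y ≡ colour′ x y
    old-edge x y xy∈E with pair u v x y in p
    ... | false = refl
    ... | true with pair-sound u v x y p
    ...   | inj₁ (refl , refl) with () ← trans (sym xy∈E) uv∉E
    ...   | inj₂ (refl , refl) with () ← trans (sym xy∈E) vu∉E

    new-edge : ∀ x y → Pair u v x y → colour″ x y ≡ α
    new-edge x y uv rewrite pair-complete u v x y uv = refl

    -- the new edge leaves u or v, where α is free
    new-edge-free : ∀ x y z → Pair u v x y → E x z ≡ true → colour′ x z ≢ α
    new-edge-free x y z (inj₁ (refl , _)) = α-free-at-u′ z
    new-edge-free x y z (inj₂ (refl , _)) = α-free-at-v′ z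

    pair-functional : ∀ x y z → Pair u v x y → Pair u v x z → y ≡ z
    pair-functional x y z (inj₁ (refl , refl)) (inj₁ (_ , refl)) = refl
    pair-functional x y z (inj₂ (refl , refl)) (inj₂ (_ , refl)) = refl
    pair-functional x y z (inj₁ (refl , refl)) (inj₂ (u≡v , _))  = ⊥-elim (u≢v u≡v)
    pair-functional x y z (inj₂ (refl , refl)) (inj₁ (v≡u , _))  = ⊥-elim (u≢v (sym v≡u))

    extended : EdgeColouring m D (λ x y → E x y ≡ true ⊎ Pair u v x y)
    extended = record { colour = colour″ ; colour-sym = colour″-sym ; proper = proper″ }
      where
      proper″ : ∀ x y z → E x y ≡ true ⊎ Pair u v x y → E x z ≡ true ⊎ Pair u v x z →
                y ≢ z → colour″ x y ≢ colour″ x z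
      proper″ x y z (inj₁ xy∈E) (inj₁ xz∈E) y≢z rewrite old-edge x y xy∈E | old-edge x z xz∈E =
        colour′-proper x y z xy∈E xz∈E y≢z
      proper″ x y z (inj₁ xy∈E) (inj₂ xz-new) y≢z rewrite old-edge x y xy∈E | new-edge x z xz-new =
        new-edge-free x z y xz-new xy∈E
      proper″ x y z (inj₂ xy-new) (inj₁ xz∈E) y≢z rewrite new-edge x y xy-new | old-edge x z xz∈E =
        new-edge-free x y z xy-new xz∈E ∘ sym
      proper″ x y z (inj₂ xy-new) (inj₂ xz-new) y≢z = ⊥-elim (y≢z (pair-functional x y z xy-new xz-new))

  listed : List (V × V) → V → V → Bool
  listed []             x y = false
  listed ((a , b) ∷ ps) x y = listed ps x y ∨ (adj H a b ∧ pair a b x y)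

  listed-sym : ∀ ps x y → listed ps x y ≡ listed ps y x
  listed-sym []             x y = refl
  listed-sym ((a , b) ∷ ps) x y = cong₂ _∨_ (listed-sym ps x y) (cong (adj H a b ∧_) (pair-sym a b x y))

  listed-cons : ∀ a b ps x y → listed ((a , b) ∷ ps) x y ≡ true →
                listed ps x y ≡ true ⊎ (Adj H a b × Pair a b x y)
  listed-cons a b ps x y e with ∨-elim {listed ps x y} e
  ... | inj₁ old = inj₁ old
  ... | inj₂ new = let ab∈H , p = ∧-elim {adj H a b} new in inj₂ (ab∈H , pair-sound a b x y p)

  listed⊆H : ∀ ps x y → listed ps x y ≡ true → Adj H x y
  listed⊆H []             x y ()
  listed⊆H ((a , b) ∷ ps) x y e with listed-cons a b ps x y e
  ... | inj₁ old                     = listed⊆H ps x y old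
  ... | inj₂ (ab∈H , inj₁ (refl , refl)) = ab∈H
  ... | inj₂ (ab∈H , inj₂ (refl , refl)) = trans (Graph.sym H x y) ab∈H

  nothing-new : ∀ a b ps → listed ps a b ≡ true ⊎ ¬ Adj H a b →
                ∀ x y → listed ((a , b) ∷ ps) x y ≡ true → listed ps x y ≡ true
  nothing-new a b ps reason x y e with listed-cons a b ps x y e | reason
  ... | inj₁ old                          | _               = old
  ... | inj₂ (ab∈H , _)                   | inj₂ ab∉H       = ⊥-elim (ab∉H ab∈H)
  ... | inj₂ (_ , inj₁ (refl , refl))     | inj₁ ab-listed  = ab-listed
  ... | inj₂ (_ , inj₂ (refl , refl))     | inj₁ ab-listed  = trans (listed-sym ps x y) ab-listed

  colourListed : ∀ ps → EdgeColouring m D (λ x y → listed ps x y ≡ true)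
  colourListed [] = record { colour = λ _ _ → someColour ; colour-sym = λ _ _ → refl ; proper = λ _ _ _ () }
  colourListed ((a , b) ∷ ps) with listed ps a b BoolP.≟ true | adj H a b BoolP.≟ true
  ... | no ab-unlisted | yes ab∈H = restrict added
      (AddEdge.extended (listed ps) (listed-sym ps) (listed⊆H ps) (colourListed ps) a b ab∈H (BoolP.¬-not ab-unlisted))
    where
    added : ∀ x y → listed ((a , b) ∷ ps) x y ≡ true → listed ps x y ≡ true ⊎ Pair a b x y
    added x y e with listed-cons a b ps x y e
    ... | inj₁ old     = inj₁ old
    ... | inj₂ (_ , p) = inj₂ p
  ... | yes ab-listed | _ = restrict (nothing-new a b ps (inj₁ ab-listed)) (colourListed ps)
  ... | no _ | no ab∉H    = restrict (nothing-new a b ps (inj₂ ab∉H)) (colourListed ps)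

  edgeColouring : EdgeColouring m D (Adj H)
  edgeColouring = restrict all-listed (colourListed allPairs)
    where
    allPairs : List (V × V)
    allPairs = cartesianProduct (allFin m) (allFin m)
    listed-∈ : ∀ {x y} ps → (x , y) ∈ ps → Adj H x y → listed ps x y ≡ true
    listed-∈ {x} {y} (_ ∷ ps) (here refl) xy∈H =
      ∨-introʳ (listed ps x y) (∧-intro xy∈H (pair-complete x y x y (inj₁ (refl , refl))))
    listed-∈ {x} {y} (_ ∷ ps) (there p) xy∈H = ∨-introˡ _ (listed-∈ ps p xy∈H)
    all-listed : ∀ x y → Adj H x y → listed allPairs x y ≡ true
    all-listed x y = listed-∈ allPairs (∈-cartesianProduct⁺ (∈-allFin x) (∈-allFin y))

adj-K : ∀ {n} (u v : Fin n) → u ≢ v → Adj (K n) u v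
adj-K u v u≢v with u ≟ v
... | yes u≡v = ⊥-elim (u≢v u≡v)
... | no _    = refl

adj-K-distinct : ∀ {n} (u v : Fin n) → Adj (K n) u v → u ≢ v
adj-K-distinct {n} u .u uu refl with () ← trans (sym uu) (Graph.irrefl (K n) u)

degree-K : ∀ n (g : Fin (suc n)) → n ≤ degree (K (suc n)) g
degree-K n g = ≤-trans (count-injection (suc n) (adj (K (suc n)) g) (punchIn g) (FinP.punchIn-injective g _ _)
                          (λ i → adj-K g (punchIn g i) (FinP.punchInᵢ≢i g i ∘ sym)))
                       (≤-reflexive (sym (degree≡count (K (suc n)) g)))

remQuot-injective : ∀ {a} b → Injective _≡_ _≡_ (remQuot {a} b)
remQuot-injective {a} b {x} {y} e = begin
  x                                    ≡⟨ FinP.combine-remQuot {a} b x ⟨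
  uncurry combine (remQuot {a} b x)    ≡⟨ cong (uncurry combine) e ⟩
  uncurry combine (remQuot {a} b y)    ≡⟨ FinP.combine-remQuot {a} b y ⟩
  y                                    ∎
  where open ≡-Reasoning

adj-combine : (G H : Graph) (g g′ : Fin (order G)) (h h′ : Fin (order H)) →
              adj (G ×ᴳ H) (combine g h) (combine g′ h′) ≡ adj G g g′ ∧ adj H h h′
adj-combine G H g g′ h h′ =
  cong₂ (λ p q → adj G (proj₁ p) (proj₁ q) ∧ adj H (proj₂ p) (proj₂ q))
        (FinP.remQuot-combine g h) (FinP.remQuot-combine g′ h′)

adj-projections : (G H : Graph) (x y : Fin (order G * order H)) → Adj (G ×ᴳ H) x y →
                  Adj G (proj₁ (remQuot {order G} (order H) x)) (proj₁ (remQuot {order G} (order H) y)) ×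
                  Adj H (proj₂ (remQuot {order G} (order H) x)) (proj₂ (remQuot {order G} (order H) y))
adj-projections G H x y = ∧-elim

degree-product : (G H : Graph) (g : Fin (order G)) (h : Fin (order H)) →
                 degree G g * degree H h ≤ degree (G ×ᴳ H) (combine g h)
degree-product G H g h
  rewrite degree≡count G g | degree≡count H h | degree≡count (G ×ᴳ H) (combine g h) =
  count-injection (order G * order H) (adj (G ×ᴳ H) (combine g h)) f f-inj f-adj
  where
  dG dH : ℕ
  dG = count (order G) (adj G g)
  dH = count (order H) (adj H h)
  enumG : Σ (Fin dG → Fin (order G)) λ e → Injective _≡_ _≡_ e × (∀ i → adj G g (e i) ≡ true)
  enumG = enumerate (order G) (adj G g)
  enumH : Σ (Fin dH → Fin (order H)) λ e → Injective _≡_ _≡_ e × (∀ i → adj H h (e i) ≡ true)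
  enumH = enumerate (order H) (adj H h)
  neighbourG : Fin (dG * dH) → Fin (order G)
  neighbourG i = proj₁ enumG (proj₁ (remQuot {dG} dH i))
  neighbourH : Fin (dG * dH) → Fin (order H)
  neighbourH i = proj₁ enumH (proj₂ (remQuot {dG} dH i))
  f : Fin (dG * dH) → Fin (order G * order H)
  f i = combine (neighbourG i) (neighbourH i)
  f-inj : Injective _≡_ _≡_ f
  f-inj {i} {j} e =
    let eG , eH = FinP.combine-injective (neighbourG i) (neighbourH i) (neighbourG j) (neighbourH j) e
    in remQuot-injective {dG} dH (cong₂ _,_ (proj₁ (proj₂ enumG) eG) (proj₁ (proj₂ enumH) eH))
  f-adj : ∀ i → adj (G ×ᴳ H) (combine g h) (f i) ≡ true
  f-adj i = trans (adj-combine G H g (neighbourG i) h (neighbourH i))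
                  (∧-intro (proj₂ (proj₂ enumG) _) (proj₂ (proj₂ enumH) _))

maxDegree-product : ∀ n′ (H : Graph) (h : Fin (order H)) → n′ * degree H h ≤ maxDegree (K (suc n′) ×ᴳ H)
maxDegree-product n′ H h = begin
  n′ * degree H h                        ≤⟨ *-mono-≤ (degree-K n′ zero) ≤-refl ⟩
  degree (K (suc n′)) zero * degree H h  ≤⟨ degree-product (K (suc n′)) H zero h ⟩
  degree (K (suc n′) ×ᴳ H) x₀            ≤⟨ degree≤maxDegree (K (suc n′) ×ᴳ H) x₀ ⟩
  maxDegree (K (suc n′) ×ᴳ H)            ∎
  where
  open ≤-Reasoning
  x₀ : Fin (suc n′ * order H)
  x₀ = combine {suc n′} zero h

widen : ∀ {G k k′} → k ≤ k′ → TotalColouring G k → TotalColouring G k′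
widen {G} {k} {k′} k≤k′ c = record
  { vcol = embed ∘ vcol
  ; ecol = λ u v p → embed (ecol u v p)
  ; ecol-sym = λ u v p q → cong embed (ecol-sym u v p q)
  ; vv = λ u v p → vv u v p ∘ embed-inj
  ; ee = λ u v w p q v≢w → ee u v w p q v≢w ∘ embed-inj
  ; ve = λ u v p → ve u v p ∘ embed-inj
  }
  where
  open TotalColouring c
  embed : Fin k → Fin k′
  embed i = inject≤ i k≤k′
  embed-inj : ∀ {i j} → embed i ≡ embed j → i ≡ j
  embed-inj = FinP.inject≤-injective k≤k′ k≤k′ _ _

edgeless-TypeI : (G : Graph) → (∀ u v → ¬ Adj G u v) → TypeI G
edgeless-TypeI G no-edge = record
  { vcol = λ _ → zero
  ; ecol = λ u v p → ⊥-elim (no-edge u v p)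
  ; ecol-sym = λ u v p _ → ⊥-elim (no-edge u v p)
  ; vv = λ u v p → ⊥-elim (no-edge u v p)
  ; ee = λ u v _ p _ → ⊥-elim (no-edge u v p)
  ; ve = λ u v p → ⊥-elim (no-edge u v p)
  }

-- The palette consists of a base block of n colours and D′ blocks of n′ colours:
--   vertex (g, h)                            ↦  L(g, g) in the base block,
--   edge (g, h)(g′, h′) with c(h h′) = 0     ↦  L(g, g′) in the base block,
--   edge (g, h)(g′, h′) with c(h h′) = j + 1 ↦  g′ - g ≠ 0 in block j,
-- where (g, h) is the endpoint with h on the true side of H, so that the edge
-- colour does not depend on the orientation.  There are n + D′ n′ = 1 + D n′
-- colours.
module ProductColouring (n′ : ℕ) (square : DiagonalLatinSquare (suc n′))
  (H : Graph) (side : Fin (order H) → Bool) (bipartite : ∀ u v → Adj H u v → side u ≢ side v)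
  (D′ : ℕ) (c : EdgeColouring (order H) (suc D′) (Adj H)) where

  n m D : ℕ
  n = suc n′
  m = order H
  D = suc D′

  open DiagonalLatinSquare square
  open EdgeColouring c
  open Cyclic n′ using (_⊕_; ⊖_; ⊕-cancelˡ; ⊕-cancelʳ; ⊖-injective; ⊕-inverseʳ)

  Palette : Set
  Palette = Fin (n + D′ * n′)

  base : Fin n → Palette
  base i = i ↑ˡ (D′ * n′)

  layer : Fin D′ → Fin n′ → Palette
  layer j i = n ↑ʳ combine j i

  -- The colour of H an element of the palette is reserved for.
  block : Palette → Fin D
  block w with splitAt n w
  ... | inj₁ _ = zero
  ... | inj₂ r = suc (proj₁ (remQuot {D′} n′ r))

  block-base : ∀ i → block (base i) ≡ zero
  block-base i rewrite FinP.splitAt-↑ˡ n i (D′ * n′) = refl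

  block-layer : ∀ j i → block (layer j i) ≡ suc j
  block-layer j i rewrite FinP.splitAt-↑ʳ n (D′ * n′) (combine j i) = cong (suc ∘ proj₁) (FinP.remQuot-combine j i)

  difference : Fin n → Fin n → Fin n
  difference g g′ = g′ ⊕ (⊖ g)

  difference≢0 : ∀ g g′ → g ≢ g′ → zero ≢ difference g g′
  difference≢0 g g′ g≢g′ e = g≢g′ (⊕-cancelʳ g g′ (⊖ g) (trans (⊕-inverseʳ g) e))

  offset : ∀ g g′ → g ≢ g′ → Fin n′
  offset g g′ g≢g′ = punchOut (difference≢0 g g′ g≢g′)

  offset-irrelevant : ∀ g g′ p q → offset g g′ p ≡ offset g g′ q
  offset-irrelevant g g′ p q =
    FinP.punchOut-cong zero {i≢j = difference≢0 g g′ p} {i≢k = difference≢0 g g′ q} refl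

  offset-injectiveʳ : ∀ g g₁ g₂ p q → offset g g₁ p ≡ offset g g₂ q → g₁ ≡ g₂
  offset-injectiveʳ g g₁ g₂ p q e =
    ⊕-cancelʳ g₁ g₂ (⊖ g) (FinP.punchOut-injective (difference≢0 g g₁ p) (difference≢0 g g₂ q) e)

  offset-injectiveˡ : ∀ g₁ g₂ g p q → offset g₁ g p ≡ offset g₂ g q → g₁ ≡ g₂
  offset-injectiveˡ g₁ g₂ g p q e =
    ⊖-injective g₁ g₂ (⊕-cancelˡ g (⊖ g₁) (⊖ g₂)
      (FinP.punchOut-injective (difference≢0 g₁ g p) (difference≢0 g₂ g q) e))

  pairColour : ∀ g g′ → g ≢ g′ → Fin D → Palette
  pairColour g g′ _ zero    = base (L g g′)
  pairColour g g′ p (suc j) = layer j (offset g g′ p)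

  oriented : Bool → ∀ g g′ → g ≢ g′ → Fin D → Palette
  oriented true  g g′ p γ = pairColour g g′ p γ
  oriented false g g′ p γ = pairColour g′ g (p ∘ sym) γ

  block-oriented : ∀ b g g′ p γ → block (oriented b g g′ p γ) ≡ γ
  block-oriented true  g g′ p zero    = block-base (L g g′)
  block-oriented true  g g′ p (suc j) = block-layer j _
  block-oriented false g g′ p zero    = block-base (L g′ g)
  block-oriented false g g′ p (suc j) = block-layer j _

  oriented-flip : ∀ b g g′ p q γ → oriented b g g′ p γ ≡ oriented (not b) g′ g q γ
  oriented-flip true  g g′ p q zero    = refl
  oriented-flip true  g g′ p q (suc j) = cong (layer j) (offset-irrelevant g g′ p (q ∘ sym))
  oriented-flip false g g′ p q zero    = refl
  oriented-flip false g g′ p q (suc j) = cong (layer j) (offset-irrelevant g′ g (p ∘ sym) q)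

  base-injective : ∀ i i′ → base i ≡ base i′ → i ≡ i′
  base-injective i i′ = FinP.↑ˡ-injective (D′ * n′) i i′

  layer-injective : ∀ j i i′ → layer j i ≡ layer j i′ → i ≡ i′
  layer-injective j i i′ e = FinP.combine-injectiveʳ j i j i′ (FinP.↑ʳ-injective n _ _ e)

  -- At a fixed column g and H-colour γ, distinct columns g₁, g₂ get distinct
  -- colours: rows and columns of L, and differences in ℤ/nℤ, are injective.
  oriented-injective : ∀ b g g₁ g₂ p q γ → oriented b g g₁ p γ ≡ oriented b g g₂ q γ → g₁ ≡ g₂
  oriented-injective true  g g₁ g₂ p q zero    e = row-injective g g₁ g₂ (base-injective _ _ e)
  oriented-injective false g g₁ g₂ p q zero    e = column-injective g₁ g₂ g (base-injective _ _ e)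
  oriented-injective true  g g₁ g₂ p q (suc j) e = offset-injectiveʳ g g₁ g₂ p q (layer-injective j _ _ e)
  oriented-injective false g g₁ g₂ p q (suc j) e =
    offset-injectiveˡ g₁ g₂ g (p ∘ sym) (q ∘ sym) (layer-injective j _ _ e)

  vertex≢oriented : ∀ b g g′ p γ → base (L g g) ≢ oriented b g g′ p γ
  vertex≢oriented true  g g′ p zero    e = p (row-injective g g g′ (base-injective _ _ e))
  vertex≢oriented false g g′ p zero    e = p (column-injective g g′ g (base-injective _ _ e))
  vertex≢oriented b     g g′ p (suc j) e with () ← trans (sym (block-base (L g g))) (trans (cong block e) (block-oriented b g g′ p (suc j)))

  P : Graph
  P = K n ×ᴳ H

  column : Fin (n * m) → Fin n
  column x = proj₁ (remQuot {n} m x)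

  row : Fin (n * m) → Fin m
  row x = proj₂ (remQuot {n} m x)

  distinct-columns : ∀ x y → Adj P x y → column x ≢ column y
  distinct-columns x y p = adj-K-distinct _ _ (proj₁ (adj-projections (K n) H x y p))

  adjacent-rows : ∀ x y → Adj P x y → Adj H (row x) (row y)
  adjacent-rows x y p = proj₂ (adj-projections (K n) H x y p)

  vertexColour : Fin (n * m) → Palette
  vertexColour x = base (L (column x) (column x))

  edgeColour : ∀ x y → Adj P x y → Palette
  edgeColour x y p = oriented (side (row x)) (column x) (column y) (distinct-columns x y p) (colour (row x) (row y))

  block-edgeColour : ∀ x y p → block (edgeColour x y p) ≡ colour (row x) (row y)
  block-edgeColour x y p =
    block-oriented (side (row x)) (column x) (column y) (distinct-columns x y p) (colour (row x) (row y))

  edgeColour-sym : ∀ x y p q → edgeColour x y p ≡ edgeColour y x q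
  edgeColour-sym x y p q = begin
    edgeColour x y p
      ≡⟨ oriented-flip (side (row x)) (column x) (column y) (distinct-columns x y p) (distinct-columns y x q) _ ⟩
    oriented (not (side (row x))) (column y) (column x) (distinct-columns y x q) (colour (row x) (row y))
      ≡⟨ cong₂ (λ b γ → oriented b (column y) (column x) (distinct-columns y x q) γ) sides (colour-sym (row x) (row y)) ⟩
    edgeColour y x q ∎
    where
    open ≡-Reasoning
    sides : not (side (row x)) ≡ side (row y)
    sides = sym (opposite-not (bipartite (row x) (row y) (adjacent-rows x y p)))

  vertex-vertex : ∀ x y → Adj P x y → vertexColour x ≢ vertexColour y
  vertex-vertex x y p e = distinct-columns x y p (diagonal-injective _ _ (base-injective _ _ e))

  edge-edge : ∀ x y z (p : Adj P x y) (q : Adj P x z) → y ≢ z → edgeColour x y p ≢ edgeColour x z q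
  edge-edge x y z p q y≢z e with row y ≟ row z
  ... | yes same-row = y≢z (remQuot-injective {n} m (cong₂ _,_ same-column same-row))
    where
    same-γ : colour (row x) (row y) ≡ colour (row x) (row z)
    same-γ = cong (colour (row x)) same-row
    same-column : column y ≡ column z
    same-column = oriented-injective (side (row x)) (column x) (column y) (column z)
      (distinct-columns x y p) (distinct-columns x z q) (colour (row x) (row y))
      (trans e (cong (oriented (side (row x)) (column x) (column z) (distinct-columns x z q)) (sym same-γ)))
  ... | no distinct-rows = proper (row x) (row y) (row z) (adjacent-rows x y p) (adjacent-rows x z q) distinct-rows
      (trans (sym (block-edgeColour x y p)) (trans (cong block e) (block-edgeColour x z q)))

  vertex-edge : ∀ x y (p : Adj P x y) → vertexColour x ≢ edgeColour x y p
  vertex-edge x y p = vertex≢oriented (side (row x)) (column x) (column y) (distinct-columns x y p) (colour (row x) (row y))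

  totalColouring : TotalColouring P (n + D′ * n′)
  totalColouring = record
    { vcol = vertexColour ; ecol = edgeColour ; ecol-sym = edgeColour-sym
    ; vv = vertex-vertex ; ee = edge-edge ; ve = vertex-edge }

corollary1 : (n : ℕ) → n ≢ 0 → n ≢ 2 → (H : Graph) → Bipartite H → TypeI (K n ×ᴳ H)
corollary1 zero n≢0 _ _ _ = ⊥-elim (n≢0 refl)
corollary1 n@(suc n′) n≢0 n≢2 H (side , bipartite) with maxDegree H in Δ | maxDegree-attained H
... | zero | _ = edgeless-TypeI (K n ×ᴳ H)
                   (λ x y p → maxDegree0-edgeless H Δ _ _ (proj₂ (adj-projections (K n) H x y p)))
... | suc D′ | inj₁ ()
... | suc D′ | inj₂ (h₀ , degree≡Δ) =
  widen palette-fits (ProductColouring.totalColouring n′ square H side bipartite D′ colouring)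
  where
  square : DiagonalLatinSquare n
  square = diagonalLatinSquare n n≢0 n≢2
  degree≤D : ∀ w → count (order H) (adj H w) ≤ suc D′
  degree≤D w = subst₂ _≤_ (degree≡count H w) Δ (degree≤maxDegree H w)
  colouring : EdgeColouring (order H) (suc D′) (Adj H)
  colouring = BipartiteEdgeColouring.edgeColouring H side bipartite (suc D′) degree≤D zero
  -- n + D′ n′ = 1 + n′ Δ(H) ≤ 1 + Δ(K n × H)
  palette-fits : n + D′ * n′ ≤ suc (maxDegree (K n ×ᴳ H))
  palette-fits = s≤s (≤-trans (≤-reflexive (trans (*-comm (suc D′) n′) (cong (n′ *_) (sym degree≡Δ))))
                              (maxDegree-product n′ H h₀))
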